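{- Let $h_0,\ldots,h_d$ be histograms with bins $1,\ldots,n$ and the same total number $m$ of data points, and let $\mathcal{H}=(H_0,\ldots,H_d)$ be the family of their cumulative histograms, each regarded as a finite set of dots. Then ${\rm EMD}(h_0,\ldots,h_d) = {\rm Vol}(\Delta(\mathcal{H}))$, the volume of the EM simplex on $\mathcal{H}$.
   Context: A histogram is $h=(h(1),\ldots,h(n))$ with nonnegative integer entries summing to $m$. Its cumulative histogram $H$ has $H(j)=\sum_{i\le j}h(i)$ and is identified with the set of dots $\{(j,k)\in\mathbb{Z}^2 : 1\le j\le n,\ 1\le k\le H(j)\}$. Moving one data point from bin $a$ to bin $b$ costs $|a-b|$ units of work; ${\rm EMD}(h_0,\ldots,h_d)$ is the minimum total work needed to transform all the $h_i$ into one common histogram (each $h_i$ transformed separately by moving its own data points). EM simplex: for a family $\mathcal{X}=(X_0,\ldots,X_d)$ of finite sets, let $\deg_{\mathcal{X}}(x)=\#\{i:x\in X_i\}$ for $x\in\cup\mathcal{X}=\bigcup_iX_i$. Faces of $\Delta(\mathcal{X})$ are all subsets $\mathcal{F}$ of $\{X_0,\ldots,X_d\}$ (vertices indexed by $0,\ldots,d$), $\dim\mathcal{F}=\#\mathcal{F}-1$; a cofacet of $\mathcal{F}$ is a face $\mathcal{G}\supset\mathcal{F}$ with $\#\mathcal{G}=\#\mathcal{F}+1$. Set $\epsilon(x)=\{X_i:x\in X_i\}$ if $\deg_{\mathcal{X}}(x)\le(d+1)/2$, else $\epsilon(x)=\{X_i:x\notin X_i\}$. Let $\lambda^{(0)}(\mathcal{F})=\{x:\epsilon(x)=\mathcal{F}\}$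 for $\dim\mathcal{F}\le\lfloor(d-1)/2\rfloor$, and $\lambda^{(1)}(\mathcal{F})$ be the multiset union of $\lambda^{(0)}(\mathcal{G})$ over cofacets $\mathcal{G}$ of $\mathcal{F}$, for $\dim\mathcal{F}\le\lfloor(d-1)/2\rfloor-1$. Then ${\rm Vol}(\Delta(\mathcal{X}))=\sum_{\mathcal{F}}|\lambda^{(1)}(\mathcal{F})|$ over those faces. -}

module Defs where

open import Data.Nat using (ℕ; zero; suc; _+_; _*_; _≤_; _<_; _≤ᵇ_; _<ᵇ_; ∣_-_∣)
open import Data.Fin using (Fin; toℕ; _≤?_)
open import Data.Bool using (Bool; true; false; if_then_else_; not; _∧_; _∨_)
open import Data.Nat.ListAction using (sum)
open import Data.List using (List; []; _∷_; map; allFin; concatMap; filter; length; _++_)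
open import Data.Vec using (Vec; []; _∷_; lookup; tabulate)
open import Data.Product using (_×_; _,_; Σ; ∃)
open import Relation.Binary.PropositionalEquality using (_≡_)
open import Relation.Nullary.Decidable using (⌊_⌋)

sumFin : ∀ n → (Fin n → ℕ) → ℕ
sumFin n f = sum (map f (allFin n))

-- Histograms with bins 1..n (bin j+1 represented by j : Fin n)

Histogram : ℕ → Set
Histogram n = Fin n → ℕ

total : ∀ {n} → Histogram n → ℕ
total {n} h = sumFin n h

cumulative : ∀ {n} → Histogram n → Fin n → ℕ
cumulative {n} h j = sumFin n (λ i → if ⌊ i ≤? j ⌋ then h i else 0)

-- Moving data points: a transport plan T a b = number of data points
-- moved from bin a to bin b (T a a = points left in place).

IsPlan : ∀ {n} → Histogram n → Histogram n → (Fin n → Fin n → ℕ) → Set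
IsPlan {n} h g T =
  ((a : Fin n) → sumFin n (λ b → T a b) ≡ h a) ×
  ((b : Fin n) → sumFin n (λ a → T a b) ≡ g b)

work : ∀ {n} → (Fin n → Fin n → ℕ) → ℕ
work {n} T = sumFin n (λ a → sumFin n (λ b → T a b * ∣ toℕ a - toℕ b ∣))

totalWork : ∀ {n d} → (Fin (suc d) → Fin n → Fin n → ℕ) → ℕ
totalWork {n} {d} T = sumFin (suc d) (λ i → work (T i))

IsEMD : ∀ {n d} → (Fin (suc d) → Histogram n) → ℕ → Set
IsEMD {n} {d} h w =
  (Σ (Histogram n) λ g → Σ (Fin (suc d) → Fin n → Fin n → ℕ) λ T →
      ((i : Fin (suc d)) → IsPlan (h i) g (T i)) × totalWork T ≡ w)
  ×
  ((g : Histogram n) (T : Fin (suc d) → Fin n → Fin n → ℕ) →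
      ((i : Fin (suc d)) → IsPlan (h i) g (T i)) → w ≤ totalWork T)

-- EM simplex of a family X_0,…,X_d of finite subsets of a finite
-- universe U (listed without repetition by `univ`), each X_i given by
-- its (Boolean) membership predicate.

Face : ℕ → Set
Face d = Vec Bool (suc d)

allSubsets : ∀ k → List (Vec Bool k)
allSubsets zero    = [] ∷ []
allSubsets (suc k) = map (false ∷_) (allSubsets k) ++ map (true ∷_) (allSubsets k)

card : ∀ {k} → Vec Bool k → ℕ
card []          = 0
card (true ∷ v)  = suc (card v)
card (false ∷ v) = card v

eqSub : ∀ {k} → Vec Bool k → Vec Bool k → Bool
eqSub [] [] = true
eqSub (true ∷ u)  (true ∷ v)  = eqSub u v
eqSub (false ∷ u) (false ∷ v) = eqSub u v
eqSub (true ∷ u)  (false ∷ v) = false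
eqSub (false ∷ u) (true ∷ v)  = false

cofacets : ∀ {d} → Face d → List (Face d)
cofacets {d} F = concatMap
  (λ i → if lookup F i then [] else (tabulate (λ j → if ⌊ j Data.Fin.≟ i ⌋ then true else lookup F j) ∷ []))
  (allFin (suc d))

module EMSimplex {U : Set} (univ : List U) {d : ℕ} (X : Fin (suc d) → U → Bool) where

  deg : U → ℕ
  deg x = sumFin (suc d) (λ i → if X i x then 1 else 0)

  inUnion : U → Bool
  inUnion x = 1 ≤ᵇ deg x

  ε : U → Face d
  ε x = tabulate (λ i → if (2 * deg x ≤ᵇ suc d) then X i x else not (X i x))

  size-λ0 : Face d → ℕ
  size-λ0 G = length (filter (λ x → Data.Bool._≟_ (inUnion x ∧ eqSub (ε x) G) true) univ)

  -- |λ⁽¹⁾(F)| = Σ_{G cofacet of F} |λ⁽⁰⁾(G)|  (multiset union)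
  size-λ1 : Face d → ℕ
  size-λ1 F = sum (map size-λ0 (cofacets F))

  -- dim F ≤ ⌊(d-1)/2⌋ - 1  ⇔  #F ≤ ⌊(d-1)/2⌋  ⇔  2·#F + 1 ≤ d
  lowFace : Face d → Bool
  lowFace F = suc (2 * card F) ≤ᵇ d

  Vol : ℕ
  Vol = sum (map (λ F → if lowFace F then size-λ1 F else 0) (allSubsets (suc d)))

-- Cumulative histograms as sets of dots (j,k), 1 ≤ k ≤ H(j).
-- Dot (j+1, k+1) is represented by (j , k) : Fin n × Fin m; since the
-- total is m, H(j) ≤ m, so every dot lies in this universe.

dotUniverse : ∀ n m → List (Fin n × Fin m)
dotUniverse n m = concatMap (λ j → map (λ k → (j , k)) (allFin m)) (allFin n)

dots : ∀ {n m} → Histogram n → Fin n × Fin m → Bool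
dots h (j , k) = toℕ k <ᵇ cumulative h j

VolEM : ∀ {n d} (m : ℕ) → (Fin (suc d) → Histogram n) → ℕ
VolEM {n} {d} m h = EMSimplex.Vol (dotUniverse n m) (λ i → dots {n} {m} (h i))

{-# OPTIONS --safe #-}
-- Both sides are sums over the dots x = (j, k) of the grid [n] × [m].
--
-- Volume: x ∈ ⋃H lies in λ⁽⁰⁾(ε(x)) only, and is counted in λ⁽¹⁾(F) once for each
-- i ∈ ε(x) with F = ε(x) ∖ {i}; as 2|ε(x)| ≤ d + 1 all these F are low faces,
-- so x contributes |ε(x)| = min(deg x, d + 1 − deg x).
--
-- Lower bound: a plan from h to g costs at least Σ_j |H(j) − G(j)|, and
-- |H(j) − G(j)| bounds the number of k for which exactly one of H, G contains
-- (j, k).  Summed over i, every dot is charged the number of H_i disagreeing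
-- with G at x, which is at least min(deg x, d + 1 − deg x).
--
-- Upper bound: let G contain x iff a strict majority of the H_i does (G is the
-- median of the H_i), and move the k-th data point of each h_i to the k-th
-- data point of g.  The distance between the two bins is the number of dots
-- of level k on which H_i and G disagree, so the total work is the sum of the
-- minority counts |ε(x)|.
module Submission where

open import Data.Bool using (Bool; true; false; if_then_else_; not; _∧_; _xor_; T)
open import Data.Bool.Properties using (xor-identityʳ; xor-comm; ∧-zeroʳ; T-≡; T-not-≡) renaming (_≟_ to _≟ᵇ_)
open import Data.Empty using (⊥-elim)
open import Data.Fin using (Fin; zero; suc; toℕ; fromℕ; _≟_; _≤?_)
open import Data.Fin.Properties using (toℕ<n)
open import Data.List using (List; []; _∷_; map; allFin; concatMap; filter; length; _++_)
open import Data.List.Properties using (map-++; map-∘; map-cong; map-tabulate)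
open import Data.Nat using (ℕ; zero; suc; _+_; _*_; _⊓_; _≤_; _<_; _≤ᵇ_; _<ᵇ_; ∣_-_∣; z≤n; s≤s; z<s)
open import Data.Nat.ListAction using (sum)
open import Data.Nat.ListAction.Properties using (sum-++)
open import Data.Nat.Properties hiding (_≟_; _≤?_)
open import Algebra.Properties.CommutativeSemigroup +-commutativeSemigroup using (interchange)
open import Data.Nat.Tactic.RingSolver using (solve-∀)
open import Data.Product using (_×_; _,_)
open import Data.Vec using (Vec; []; _∷_; lookup; _[_]≔_) renaming (tabulate to tabulateᵛ)
open import Data.Vec.Properties using (lookup∘tabulate; tabulate∘lookup; tabulate-cong)
open import Function using (_∘_; id; Equivalence)
open import Relation.Binary.PropositionalEquality
open import Relation.Nullary.Decidable using (⌊_⌋; ⌊⌋-map′; T?)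

open import Defs

𝟙 : Bool → ℕ
𝟙 b = if b then 1 else 0

if-then-0≡𝟙* : ∀ b y → (if b then y else 0) ≡ 𝟙 b * y
if-then-0≡𝟙* true  y = sym (*-identityˡ y)
if-then-0≡𝟙* false y = refl

𝟙-∧ : ∀ a b → 𝟙 (a ∧ b) ≡ 𝟙 a * 𝟙 b
𝟙-∧ true  b = sym (*-identityˡ (𝟙 b))
𝟙-∧ false b = refl

𝟙+𝟙-not : ∀ b → 𝟙 b + 𝟙 (not b) ≡ 1
𝟙+𝟙-not true  = refl
𝟙+𝟙-not false = refl

𝟙*𝟙≡𝟙ʳ : ∀ a b → (T b → T a) → 𝟙 a * 𝟙 b ≡ 𝟙 b
𝟙*𝟙≡𝟙ʳ a     false _   = *-zeroʳ (𝟙 a)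
𝟙*𝟙≡𝟙ʳ true  true  _   = refl
𝟙*𝟙≡𝟙ʳ false true  b⇒a = ⊥-elim (b⇒a _)

𝟙-mono-≤ : ∀ {a b} → (T a → T b) → 𝟙 a ≤ 𝟙 b
𝟙-mono-≤ {false}        _   = z≤n
𝟙-mono-≤ {true} {true}  _   = ≤-refl
𝟙-mono-≤ {true} {false} a⇒b = ⊥-elim (a⇒b _)

T-not-≤ᵇ⇒> : ∀ {m n} → T (not (m ≤ᵇ n)) → n < m
T-not-≤ᵇ⇒> t = ≰⇒> (λ m≤n → subst T (Equivalence.to T-not-≡ t) (≤⇒≤ᵇ m≤n))

>⇒T-not-≤ᵇ : ∀ {m n} → n < m → T (not (m ≤ᵇ n))
>⇒T-not-≤ᵇ {m} {n} n<m with m ≤ᵇ n in m≤ᵇn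
... | false = _
... | true  = <⇒≱ n<m (≤ᵇ⇒≤ m n (Equivalence.from T-≡ m≤ᵇn))

2*m≤m+n⇒m≤n : ∀ {m n} → 2 * m ≤ m + n → m ≤ n
2*m≤m+n⇒m≤n {m} {n} le = +-cancelˡ-≤ m m n (subst (_≤ m + n) (cong (m +_) (+-identityʳ m)) le)

m≤n⇒2*m≤m+n : ∀ {m n} → m ≤ n → 2 * m ≤ m + n
m≤n⇒2*m≤m+n {m} {n} le = +-monoʳ-≤ m (subst (_≤ n) (sym (+-identityʳ m)) le)

𝟙*-≤ : ∀ b y → 𝟙 b * y ≤ y
𝟙*-≤ true  y = ≤-reflexive (*-identityˡ y)
𝟙*-≤ false y = z≤n

∑ : {A : Set} → List A → (A → ℕ) → ℕ
∑ xs f = sum (map f xs)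

module _ {A : Set} where

  ∑-cong : ∀ xs {f g : A → ℕ} → (∀ x → f x ≡ g x) → ∑ xs f ≡ ∑ xs g
  ∑-cong xs f≗g = cong sum (map-cong f≗g xs)

  ∑-zero : ∀ xs {f : A → ℕ} → (∀ x → f x ≡ 0) → ∑ xs f ≡ 0
  ∑-zero []       f≗0 = refl
  ∑-zero (x ∷ xs) f≗0 = cong₂ _+_ (f≗0 x) (∑-zero xs f≗0)

  ∑-mono-≤ : ∀ xs {f g : A → ℕ} → (∀ x → f x ≤ g x) → ∑ xs f ≤ ∑ xs g
  ∑-mono-≤ []       f≤g = z≤n
  ∑-mono-≤ (x ∷ xs) f≤g = +-mono-≤ (f≤g x) (∑-mono-≤ xs f≤g)

  ∑-distrib-+ : ∀ xs (f g : A → ℕ) → ∑ xs (λ x → f x + g x) ≡ ∑ xs f + ∑ xs g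
  ∑-distrib-+ []       f g = refl
  ∑-distrib-+ (x ∷ xs) f g =
    trans (cong (f x + g x +_) (∑-distrib-+ xs f g)) (interchange (f x) (g x) (∑ xs f) (∑ xs g))

  *-distribˡ-∑ : ∀ c xs (f : A → ℕ) → c * ∑ xs f ≡ ∑ xs (λ x → c * f x)
  *-distribˡ-∑ c []       f = *-zeroʳ c
  *-distribˡ-∑ c (x ∷ xs) f = trans (*-distribˡ-+ c (f x) (∑ xs f)) (cong (c * f x +_) (*-distribˡ-∑ c xs f))

  ∑-++ : ∀ xs ys (f : A → ℕ) → ∑ (xs ++ ys) f ≡ ∑ xs f + ∑ ys f
  ∑-++ xs ys f = trans (cong sum (map-++ f xs ys)) (sum-++ (map f xs) (map f ys))

  ∑-map : ∀ {B : Set} (g : B → A) ys (f : A → ℕ) → ∑ (map g ys) f ≡ ∑ ys (f ∘ g)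
  ∑-map g ys f = cong sum (sym (map-∘ ys))

  ∑-∣-∣ : ∀ xs (f g : A → ℕ) → ∣ ∑ xs f - ∑ xs g ∣ ≤ ∑ xs (λ x → ∣ f x - g x ∣)
  ∑-∣-∣ []       f g = z≤n
  ∑-∣-∣ (x ∷ xs) f g =
    ≤-trans (∣a+b-c+e∣≤ (f x) (∑ xs f) (g x) (∑ xs g)) (+-monoʳ-≤ ∣ f x - g x ∣ (∑-∣-∣ xs f g))
    where
    ∣a+b-c+e∣≤ : ∀ a b c e → ∣ a + b - (c + e) ∣ ≤ ∣ a - c ∣ + ∣ b - e ∣
    ∣a+b-c+e∣≤ a b c e = ≤-trans (∣-∣-triangle (a + b) (c + b) (c + e))
      (+-mono-≤ (≤-reflexive (trans (cong₂ ∣_-_∣ (+-comm a b) (+-comm c b)) (∣m+n-m+o∣≡∣n-o∣ b a c)))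
                (≤-reflexive (∣m+n-m+o∣≡∣n-o∣ c b e)))

  length-filter≡∑𝟙 : ∀ (p : A → Bool) xs → length (filter (λ x → p x ≟ᵇ true) xs) ≡ ∑ xs (𝟙 ∘ p)
  length-filter≡∑𝟙 p []       = refl
  length-filter≡∑𝟙 p (x ∷ xs) with p x
  ... | true  = cong suc (length-filter≡∑𝟙 p xs)
  ... | false = length-filter≡∑𝟙 p xs

∑-comm : ∀ {A B : Set} xs ys (f : A → B → ℕ) →
  ∑ xs (λ x → ∑ ys (f x)) ≡ ∑ ys (λ y → ∑ xs (λ x → f x y))
∑-comm []       ys f = sym (∑-zero ys (λ _ → refl))
∑-comm (x ∷ xs) ys f =
  trans (cong (∑ ys (f x) +_) (∑-comm xs ys f)) (sym (∑-distrib-+ ys (f x) (λ y → ∑ xs (λ x′ → f x′ y))))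

∑-rotate : ∀ {A B C : Set} xs ys zs (f : A → B → C → ℕ) →
  ∑ xs (λ x → ∑ ys (λ y → ∑ zs (f x y))) ≡ ∑ ys (λ y → ∑ zs (λ z → ∑ xs (λ x → f x y z)))
∑-rotate xs ys zs f = trans (∑-comm xs ys _) (∑-cong ys (λ y → ∑-comm xs zs (λ x → f x y)))

∑-concatMap : ∀ {A B : Set} (g : A → List B) xs (f : B → ℕ) → ∑ (concatMap g xs) f ≡ ∑ xs (λ x → ∑ (g x) f)
∑-concatMap g []       f = refl
∑-concatMap g (x ∷ xs) f = trans (∑-++ (g x) (concatMap g xs) f) (cong (∑ (g x) f +_) (∑-concatMap g xs f))

sumFin-suc : ∀ n (f : Fin (suc n) → ℕ) → sumFin (suc n) f ≡ f zero + sumFin n (f ∘ suc)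
sumFin-suc n f = cong (λ xs → f zero + sum xs) (trans (map-tabulate suc f) (sym (map-tabulate id (f ∘ suc))))

sumFin-1 : ∀ n → sumFin n (λ _ → 1) ≡ n
sumFin-1 zero    = refl
sumFin-1 (suc n) = trans (sumFin-suc n (λ _ → 1)) (cong suc (sumFin-1 n))

sumFin-𝟙≟* : ∀ n (c : Fin n) (f : Fin n → ℕ) → sumFin n (λ b → 𝟙 ⌊ b ≟ c ⌋ * f b) ≡ f c
sumFin-𝟙≟* (suc n) zero    f = begin
  sumFin (suc n) (λ b → 𝟙 ⌊ b ≟ zero ⌋ * f b)  ≡⟨ sumFin-suc n _ ⟩
  1 * f zero + sumFin n (λ _ → 0)               ≡⟨ cong₂ _+_ (*-identityˡ (f zero)) (∑-zero (allFin n) (λ _ → refl)) ⟩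
  f zero + 0                                    ≡⟨ +-identityʳ (f zero) ⟩
  f zero                                        ∎
  where open ≡-Reasoning
sumFin-𝟙≟* (suc n) (suc c) f = trans (sumFin-suc n (λ b → 𝟙 ⌊ b ≟ suc c ⌋ * f b))
  (trans (∑-cong (allFin n) (λ b → cong (λ e → 𝟙 e * f (suc b)) (⌊⌋-map′ _ _ (b ≟ c))))
         (sumFin-𝟙≟* n c (f ∘ suc)))

sumFin-*𝟙≟ : ∀ n x (c : Fin n) → sumFin n (λ b → x * 𝟙 ⌊ b ≟ c ⌋) ≡ x
sumFin-*𝟙≟ n x c = trans (∑-cong (allFin n) (λ b → *-comm x (𝟙 ⌊ b ≟ c ⌋))) (sumFin-𝟙≟* n c (λ _ → x))

-- Prefix sums and transport plans on a line

-- Unlike ⌊ a ≤? b ⌋, which goes through toℕ, this comparison computes on zero/suc.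
infix 5 _≤ᶠ_
_≤ᶠ_ : ∀ {n} → Fin n → Fin n → Bool
zero  ≤ᶠ _     = true
suc a ≤ᶠ zero  = false
suc a ≤ᶠ suc b = a ≤ᶠ b

⌊≤?⌋≡≤ᶠ : ∀ {n} (a b : Fin n) → ⌊ a ≤? b ⌋ ≡ a ≤ᶠ b
⌊≤?⌋≡≤ᶠ zero    b       = refl
⌊≤?⌋≡≤ᶠ (suc a) zero    = refl
⌊≤?⌋≡≤ᶠ (suc a) (suc b) = begin
  ⌊ suc a ≤? suc b ⌋             ≡⟨ ⌊⌋-map′ _ _ (T? _) ⟩
  ⌊ T? (toℕ a <ᵇ suc (toℕ b)) ⌋  ≡⟨ cong (⌊_⌋ ∘ T?) (≤ᵇ≡<ᵇsuc (toℕ a) (toℕ b)) ⟨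
  ⌊ T? (toℕ a ≤ᵇ toℕ b) ⌋        ≡⟨ ⌊⌋-map′ _ _ (T? _) ⟨
  ⌊ a ≤? b ⌋                     ≡⟨ ⌊≤?⌋≡≤ᶠ a b ⟩
  a ≤ᶠ b                         ∎
  where
  open ≡-Reasoning
  ≤ᵇ≡<ᵇsuc : ∀ x y → (x ≤ᵇ y) ≡ (x <ᵇ suc y)
  ≤ᵇ≡<ᵇsuc zero    y = refl
  ≤ᵇ≡<ᵇsuc (suc x) y = refl

≤ᶠ-trans : ∀ {n} {a b c : Fin n} → T (a ≤ᶠ b) → T (b ≤ᶠ c) → T (a ≤ᶠ c)
≤ᶠ-trans {a = zero}                          _   _   = _
≤ᶠ-trans {a = suc a} {suc b} {suc c} a≤b b≤c = ≤ᶠ-trans {a = a} {b} {c} a≤b b≤c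

≤ᶠ-fromℕ : ∀ n (a : Fin (suc n)) → T (a ≤ᶠ fromℕ n)
≤ᶠ-fromℕ n       zero    = _
≤ᶠ-fromℕ (suc n) (suc a) = ≤ᶠ-fromℕ n a

toℕ≡∑𝟙-not-≤ᶠ : ∀ n (b : Fin n) → sumFin n (λ j → 𝟙 (not (b ≤ᶠ j))) ≡ toℕ b
toℕ≡∑𝟙-not-≤ᶠ (suc n) zero    = ∑-zero (allFin (suc n)) (λ _ → refl)
toℕ≡∑𝟙-not-≤ᶠ (suc n) (suc b) =
  trans (sumFin-suc n (λ j → 𝟙 (not (suc b ≤ᶠ j)))) (cong suc (toℕ≡∑𝟙-not-≤ᶠ n b))

∣toℕ-toℕ∣≡∑𝟙-xor : ∀ n (a b : Fin n) →
  ∣ toℕ a - toℕ b ∣ ≡ sumFin n (λ j → 𝟙 ((a ≤ᶠ j) xor (b ≤ᶠ j)))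
∣toℕ-toℕ∣≡∑𝟙-xor (suc n) zero    zero    = sym (∑-zero (allFin (suc n)) (λ _ → refl))
∣toℕ-toℕ∣≡∑𝟙-xor (suc n) zero    (suc b) =
  sym (trans (sumFin-suc n (λ j → 𝟙 ((zero ≤ᶠ j) xor (suc b ≤ᶠ j)))) (cong suc (toℕ≡∑𝟙-not-≤ᶠ n b)))
∣toℕ-toℕ∣≡∑𝟙-xor (suc n) (suc a) zero    =
  sym (trans (sumFin-suc n (λ j → 𝟙 ((suc a ≤ᶠ j) xor (zero ≤ᶠ j))))
    (cong suc (trans (∑-cong (allFin n) (λ j → cong 𝟙 (xor-comm (a ≤ᶠ j) true))) (toℕ≡∑𝟙-not-≤ᶠ n a))))
∣toℕ-toℕ∣≡∑𝟙-xor (suc n) (suc a) (suc b) =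
  trans (∣toℕ-toℕ∣≡∑𝟙-xor n a b) (sym (sumFin-suc n (λ j → 𝟙 ((suc a ≤ᶠ j) xor (suc b ≤ᶠ j)))))

prefixSum : ∀ {n} → (Fin n → ℕ) → Fin n → ℕ
prefixSum {n} f j = sumFin n (λ i → 𝟙 (i ≤ᶠ j) * f i)

cumulative≡prefixSum : ∀ {n} (h : Histogram n) j → cumulative h j ≡ prefixSum h j
cumulative≡prefixSum {n} h j = ∑-cong (allFin n) (λ i →
  trans (cong (λ b → if b then h i else 0) (⌊≤?⌋≡≤ᶠ i j)) (if-then-0≡𝟙* (i ≤ᶠ j) (h i)))

prefixSum-mono-≤ : ∀ {n} (f : Fin n → ℕ) {a b} → T (a ≤ᶠ b) → prefixSum f a ≤ prefixSum f b
prefixSum-mono-≤ {n} f {a} {b} a≤b = ∑-mono-≤ (allFin n) 𝟙≤𝟙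
  where
  𝟙≤𝟙 : ∀ i → 𝟙 (i ≤ᶠ a) * f i ≤ 𝟙 (i ≤ᶠ b) * f i
  𝟙≤𝟙 i with i ≤ᶠ a in i≤a
  ... | false = z≤n
  ... | true rewrite Equivalence.to T-≡ (≤ᶠ-trans {a = i} (Equivalence.from T-≡ i≤a) a≤b) = ≤-refl

cumulative-mono-≤ : ∀ {n} (h : Histogram n) {a b} → T (a ≤ᶠ b) → cumulative h a ≤ cumulative h b
cumulative-mono-≤ h {a} {b} a≤b =
  subst₂ _≤_ (sym (cumulative≡prefixSum h a)) (sym (cumulative≡prefixSum h b)) (prefixSum-mono-≤ h a≤b)

prefixSum≤sumFin : ∀ {n} (f : Fin n → ℕ) j → prefixSum f j ≤ sumFin n f
prefixSum≤sumFin {n} f j = ∑-mono-≤ (allFin n) (λ i → 𝟙*-≤ (i ≤ᶠ j) (f i))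

prefixSum-fromℕ : ∀ {n} (f : Fin (suc n) → ℕ) → prefixSum f (fromℕ n) ≡ sumFin (suc n) f
prefixSum-fromℕ {n} f = ∑-cong (allFin (suc n)) (λ i →
  trans (cong (λ b → 𝟙 b * f i) (Equivalence.to T-≡ (≤ᶠ-fromℕ n i))) (*-identityˡ (f i)))

prefixSum-zero : ∀ {n} (f : Fin (suc n) → ℕ) → prefixSum f zero ≡ f zero
prefixSum-zero {n} f = trans (sumFin-suc n (λ i → 𝟙 (i ≤ᶠ zero) * f i))
  (trans (cong₂ _+_ (*-identityˡ (f zero)) (∑-zero (allFin n) (λ _ → refl))) (+-identityʳ (f zero)))

prefixSum-suc : ∀ {n} (f : Fin (suc n) → ℕ) j → prefixSum f (suc j) ≡ f zero + prefixSum (f ∘ suc) j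
prefixSum-suc {n} f j =
  trans (sumFin-suc n (λ i → 𝟙 (i ≤ᶠ suc j) * f i)) (cong (_+ prefixSum (f ∘ suc) j) (*-identityˡ (f zero)))

prefixSum-injective : ∀ {n} {f g : Fin n → ℕ} → (∀ j → prefixSum f j ≡ prefixSum g j) → ∀ a → f a ≡ g a
prefixSum-injective {suc n} {f} {g} f≗g = go
  where
  f₀≡g₀ : f zero ≡ g zero
  f₀≡g₀ = trans (sym (prefixSum-zero f)) (trans (f≗g zero) (prefixSum-zero g))
  tails : ∀ j → prefixSum (f ∘ suc) j ≡ prefixSum (g ∘ suc) j
  tails j = +-cancelˡ-≡ (f zero) _ _
    (trans (sym (prefixSum-suc f j)) (trans (f≗g (suc j)) (trans (prefixSum-suc g j) (cong (_+ _) (sym f₀≡g₀)))))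
  go : ∀ a → f a ≡ g a
  go zero    = f₀≡g₀
  go (suc a) = prefixSum-injective tails a

∑∣cumulative-cumulative∣≤work : ∀ {n} {h g : Histogram n} {τ : Fin n → Fin n → ℕ} → IsPlan h g τ →
  sumFin n (λ j → ∣ cumulative h j - cumulative g j ∣) ≤ work τ
∑∣cumulative-cumulative∣≤work {n} {h} {g} {τ} (rows , cols) = begin
  sumFin n (λ j → ∣ cumulative h j - cumulative g j ∣)
    ≡⟨ ∑-cong Fn (λ j → cong₂ ∣_-_∣ (cumulative-source j) (cumulative-target j)) ⟩
  sumFin n (λ j → ∣ ∑ Fn (λ a → ∑ Fn (λ b → 𝟙 (a ≤ᶠ j) * τ a b))
                  - ∑ Fn (λ a → ∑ Fn (λ b → 𝟙 (b ≤ᶠ j) * τ a b)) ∣)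
    ≤⟨ ∑-mono-≤ Fn (λ j → ≤-trans (∑-∣-∣ Fn _ _) (∑-mono-≤ Fn (λ a → ≤-trans (∑-∣-∣ Fn _ _)
         (≤-reflexive (∑-cong Fn (λ b → ∣𝟙*-𝟙*∣ (a ≤ᶠ j) (b ≤ᶠ j) (τ a b))))))) ⟩
  sumFin n (λ j → ∑ Fn (λ a → ∑ Fn (λ b → 𝟙 ((a ≤ᶠ j) xor (b ≤ᶠ j)) * τ a b)))
    ≡⟨ ∑-comm Fn Fn _ ⟩
  ∑ Fn (λ a → ∑ Fn (λ j → ∑ Fn (λ b → 𝟙 ((a ≤ᶠ j) xor (b ≤ᶠ j)) * τ a b)))
    ≡⟨ ∑-cong Fn (λ a → trans (∑-comm Fn Fn _) (∑-cong Fn (λ b → distance a b))) ⟩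
  work τ ∎
  where
  open ≤-Reasoning
  Fn = allFin n
  cumulative-source : ∀ j → cumulative h j ≡ ∑ Fn (λ a → ∑ Fn (λ b → 𝟙 (a ≤ᶠ j) * τ a b))
  cumulative-source j = trans (cumulative≡prefixSum h j)
    (∑-cong Fn (λ a → trans (cong (𝟙 (a ≤ᶠ j) *_) (sym (rows a))) (*-distribˡ-∑ (𝟙 (a ≤ᶠ j)) Fn (τ a))))
  cumulative-target : ∀ j → cumulative g j ≡ ∑ Fn (λ a → ∑ Fn (λ b → 𝟙 (b ≤ᶠ j) * τ a b))
  cumulative-target j = trans (cumulative≡prefixSum g j)
    (trans (∑-cong Fn (λ b → trans (cong (𝟙 (b ≤ᶠ j) *_) (sym (cols b)))
                                   (*-distribˡ-∑ (𝟙 (b ≤ᶠ j)) Fn (λ a → τ a b))))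
           (∑-comm Fn Fn (λ b a → 𝟙 (b ≤ᶠ j) * τ a b)))
  ∣𝟙*-𝟙*∣ : ∀ p q t → ∣ 𝟙 p * t - 𝟙 q * t ∣ ≡ 𝟙 (p xor q) * t
  ∣𝟙*-𝟙*∣ true  true  t = ∣n-n∣≡0 (t + 0)
  ∣𝟙*-𝟙*∣ true  false t = ∣-∣-identityʳ (t + 0)
  ∣𝟙*-𝟙*∣ false true  t = refl
  ∣𝟙*-𝟙*∣ false false t = refl
  distance : ∀ a b → sumFin n (λ j → 𝟙 ((a ≤ᶠ j) xor (b ≤ᶠ j)) * τ a b) ≡ τ a b * ∣ toℕ a - toℕ b ∣
  distance a b = trans (∑-cong Fn (λ j → *-comm _ (τ a b)))
    (trans (sym (*-distribˡ-∑ (τ a b) Fn _)) (cong (τ a b *_) (sym (∣toℕ-toℕ∣≡∑𝟙-xor n a b))))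

∑𝟙<ᵇ≤ : ∀ m c → sumFin m (λ k → 𝟙 (toℕ k <ᵇ c)) ≤ c
∑𝟙<ᵇ≤ m       zero    = ≤-reflexive (∑-zero (allFin m) (λ k → refl))
∑𝟙<ᵇ≤ zero    (suc c) = z≤n
∑𝟙<ᵇ≤ (suc m) (suc c) =
  ≤-trans (≤-reflexive (sumFin-suc m (λ k → 𝟙 (toℕ k <ᵇ suc c)))) (s≤s (∑𝟙<ᵇ≤ m c))

∑𝟙<ᵇ≡ : ∀ m c → c ≤ m → sumFin m (λ k → 𝟙 (toℕ k <ᵇ c)) ≡ c
∑𝟙<ᵇ≡ m       zero    _         = ∑-zero (allFin m) (λ k → refl)
∑𝟙<ᵇ≡ (suc m) (suc c) (s≤s c≤m) =
  trans (sumFin-suc m (λ k → 𝟙 (toℕ k <ᵇ suc c))) (cong suc (∑𝟙<ᵇ≡ m c c≤m))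

∑𝟙-xor-<ᵇ≤∣-∣ : ∀ m a c → sumFin m (λ k → 𝟙 ((toℕ k <ᵇ a) xor (toℕ k <ᵇ c))) ≤ ∣ a - c ∣
∑𝟙-xor-<ᵇ≤∣-∣ m       zero    c       = ∑𝟙<ᵇ≤ m c
∑𝟙-xor-<ᵇ≤∣-∣ m       (suc a) zero    =
  ≤-trans (≤-reflexive (∑-cong (allFin m) (λ k → cong 𝟙 (xor-identityʳ (toℕ k <ᵇ suc a))))) (∑𝟙<ᵇ≤ m (suc a))
∑𝟙-xor-<ᵇ≤∣-∣ zero    (suc a) (suc c) = z≤n
∑𝟙-xor-<ᵇ≤∣-∣ (suc m) (suc a) (suc c) =
  ≤-trans (≤-reflexive (sumFin-suc m (λ k → 𝟙 ((toℕ k <ᵇ suc a) xor (toℕ k <ᵇ suc c)))))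
          (∑𝟙-xor-<ᵇ≤∣-∣ m a c)

Monotone : ∀ {n} → (Fin n → Bool) → Set
Monotone p = ∀ {a b} → T (a ≤ᶠ b) → T (p a) → T (p b)

least : ∀ {n} → (Fin (suc n) → Bool) → Fin (suc n)
least {zero}  p = zero
least {suc n} p = if p zero then zero else suc (least (p ∘ suc))

least-≤ᶠ : ∀ {n} (p : Fin (suc n) → Bool) → Monotone p → T (p (fromℕ n)) → ∀ j → least p ≤ᶠ j ≡ p j
least-≤ᶠ {zero}  p mono pₙ zero = sym (Equivalence.to T-≡ pₙ)
least-≤ᶠ {suc n} p mono pₙ j with p zero in p₀
... | true = sym (Equivalence.to T-≡ (mono {zero} {j} _ (Equivalence.from T-≡ p₀)))
least-≤ᶠ {suc n} p mono pₙ zero    | false = sym p₀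
least-≤ᶠ {suc n} p mono pₙ (suc j) | false = least-≤ᶠ (p ∘ suc) mono pₙ j

module _ {m n : ℕ} where

  histogramOf : (Fin m → Fin n) → Histogram n
  histogramOf α a = sumFin m (λ k → 𝟙 ⌊ a ≟ α k ⌋)

  coupling : (Fin m → Fin n) → (Fin m → Fin n) → Fin n → Fin n → ℕ
  coupling α β a b = sumFin m (λ k → 𝟙 ⌊ a ≟ α k ⌋ * 𝟙 ⌊ b ≟ β k ⌋)

  private
    Fm = allFin m
    Fn = allFin n

  coupling-isPlan : ∀ α β → IsPlan (histogramOf α) (histogramOf β) (coupling α β)
  coupling-isPlan α β = rows , cols
    where
    rows : ∀ a → sumFin n (coupling α β a) ≡ histogramOf α a
    rows a = trans (∑-comm Fn Fm _) (∑-cong Fm (λ k → sumFin-*𝟙≟ n (𝟙 ⌊ a ≟ α k ⌋) (β k)))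
    cols : ∀ b → sumFin n (λ a → coupling α β a b) ≡ histogramOf β b
    cols b = trans (∑-comm Fn Fm _) (∑-cong Fm (λ k →
      trans (∑-cong Fn (λ a → *-comm (𝟙 ⌊ a ≟ α k ⌋) _)) (sumFin-*𝟙≟ n (𝟙 ⌊ b ≟ β k ⌋) (α k))))

  prefixSum-histogramOf : ∀ α j → prefixSum (histogramOf α) j ≡ sumFin m (λ k → 𝟙 (α k ≤ᶠ j))
  prefixSum-histogramOf α j = begin
    ∑ Fn (λ a → 𝟙 (a ≤ᶠ j) * ∑ Fm (λ k → 𝟙 ⌊ a ≟ α k ⌋))
      ≡⟨ ∑-cong Fn (λ a → *-distribˡ-∑ (𝟙 (a ≤ᶠ j)) Fm _) ⟩
    ∑ Fn (λ a → ∑ Fm (λ k → 𝟙 (a ≤ᶠ j) * 𝟙 ⌊ a ≟ α k ⌋))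
      ≡⟨ ∑-comm Fn Fm _ ⟩
    ∑ Fm (λ k → ∑ Fn (λ a → 𝟙 (a ≤ᶠ j) * 𝟙 ⌊ a ≟ α k ⌋))
      ≡⟨ ∑-cong Fm (λ k → trans (∑-cong Fn (λ a → *-comm (𝟙 (a ≤ᶠ j)) _))
                                (sumFin-𝟙≟* n (α k) (λ a → 𝟙 (a ≤ᶠ j)))) ⟩
    ∑ Fm (λ k → 𝟙 (α k ≤ᶠ j)) ∎
    where open ≡-Reasoning

  work-coupling : ∀ α β → work (coupling α β) ≡ sumFin m (λ k → ∣ toℕ (α k) - toℕ (β k) ∣)
  work-coupling α β = begin
    ∑ Fn (λ a → ∑ Fn (λ b → coupling α β a b * d a b))
      ≡⟨ ∑-cong Fn (λ a → ∑-cong Fn (λ b → trans (*-comm _ (d a b)) (*-distribˡ-∑ (d a b) Fm _))) ⟩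
    ∑ Fn (λ a → ∑ Fn (λ b → ∑ Fm (λ k → d a b * (δ a (α k) * δ b (β k)))))
      ≡⟨ ∑-cong Fn (λ a → ∑-comm Fn Fm _) ⟩
    ∑ Fn (λ a → ∑ Fm (λ k → ∑ Fn (λ b → d a b * (δ a (α k) * δ b (β k)))))
      ≡⟨ ∑-comm Fn Fm _ ⟩
    ∑ Fm (λ k → ∑ Fn (λ a → ∑ Fn (λ b → d a b * (δ a (α k) * δ b (β k)))))
      ≡⟨ ∑-cong Fm (λ k → ∑-cong Fn (λ a → trans (∑-cong Fn (λ b → rearrange (d a b) (δ a (α k)) (δ b (β k))))
           (trans (sym (*-distribˡ-∑ (δ a (α k)) Fn _)) (cong (δ a (α k) *_) (sumFin-𝟙≟* n (β k) (d a)))))) ⟩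
    ∑ Fm (λ k → ∑ Fn (λ a → δ a (α k) * d a (β k)))
      ≡⟨ ∑-cong Fm (λ k → sumFin-𝟙≟* n (α k) (λ a → d a (β k))) ⟩
    ∑ Fm (λ k → d (α k) (β k)) ∎
    where
    open ≡-Reasoning
    d : Fin n → Fin n → ℕ
    d a b = ∣ toℕ a - toℕ b ∣
    δ : Fin n → Fin n → ℕ
    δ a c = 𝟙 ⌊ a ≟ c ⌋
    rearrange : ∀ x y z → x * (y * z) ≡ y * (z * x)
    rearrange x y z = trans (*-comm x (y * z)) (*-assoc y z x)

-- Subsets of the vertex set as Boolean vectors

tabulate-insert≡[]≔true : ∀ {k} (F : Vec Bool k) i →
  tabulateᵛ (λ j → if ⌊ j ≟ i ⌋ then true else lookup F j) ≡ F [ i ]≔ true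
tabulate-insert≡[]≔true (b ∷ F) zero    = cong (true ∷_) (tabulate∘lookup F)
tabulate-insert≡[]≔true (b ∷ F) (suc i) = cong (b ∷_) (trans
  (tabulate-cong (λ j → cong (λ e → if e then true else lookup F j) (⌊⌋-map′ _ _ (j ≟ i))))
  (tabulate-insert≡[]≔true F i))

eqSub-sym : ∀ {k} (E F : Vec Bool k) → eqSub E F ≡ eqSub F E
eqSub-sym []          []          = refl
eqSub-sym (true ∷ E)  (true ∷ F)  = eqSub-sym E F
eqSub-sym (true ∷ E)  (false ∷ F) = refl
eqSub-sym (false ∷ E) (true ∷ F)  = refl
eqSub-sym (false ∷ E) (false ∷ F) = eqSub-sym E F

insert-eqSub≡remove-eqSub : ∀ {k} (E F : Vec Bool k) i →
  (not (lookup F i) ∧ eqSub E (F [ i ]≔ true)) ≡ (lookup E i ∧ eqSub F (E [ i ]≔ false))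
insert-eqSub≡remove-eqSub (true ∷ E)  (true ∷ F)  zero    = refl
insert-eqSub≡remove-eqSub (true ∷ E)  (false ∷ F) zero    = eqSub-sym E F
insert-eqSub≡remove-eqSub (false ∷ E) (true ∷ F)  zero    = refl
insert-eqSub≡remove-eqSub (false ∷ E) (false ∷ F) zero    = refl
insert-eqSub≡remove-eqSub (true ∷ E)  (true ∷ F)  (suc i) = insert-eqSub≡remove-eqSub E F i
insert-eqSub≡remove-eqSub (false ∷ E) (false ∷ F) (suc i) = insert-eqSub≡remove-eqSub E F i
insert-eqSub≡remove-eqSub (true ∷ E)  (false ∷ F) (suc i) = trans (∧-zeroʳ _) (sym (∧-zeroʳ _))
insert-eqSub≡remove-eqSub (false ∷ E) (true ∷ F)  (suc i) = trans (∧-zeroʳ _) (sym (∧-zeroʳ _))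

∑-allSubsets-𝟙eqSub* : ∀ k (V : Vec Bool k) (ψ : Vec Bool k → ℕ) →
  ∑ (allSubsets k) (λ F → 𝟙 (eqSub F V) * ψ F) ≡ ψ V
∑-allSubsets-𝟙eqSub* zero    []      ψ = trans (+-identityʳ (1 * ψ [])) (*-identityˡ (ψ []))
∑-allSubsets-𝟙eqSub* (suc k) (b ∷ V) ψ = begin
  ∑ (map (false ∷_) Sₖ ++ map (true ∷_) Sₖ) summand
    ≡⟨ ∑-++ (map (false ∷_) Sₖ) (map (true ∷_) Sₖ) summand ⟩
  ∑ (map (false ∷_) Sₖ) summand + ∑ (map (true ∷_) Sₖ) summand
    ≡⟨ cong₂ _+_ (∑-map (false ∷_) Sₖ summand) (∑-map (true ∷_) Sₖ summand) ⟩
  ∑ Sₖ (λ F → summand (false ∷ F)) + ∑ Sₖ (λ F → summand (true ∷ F))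
    ≡⟨ split b ⟩
  ψ (b ∷ V) ∎
  where
  open ≡-Reasoning
  Sₖ = allSubsets k
  summand : Vec Bool (suc k) → ℕ
  summand F = 𝟙 (eqSub F (b ∷ V)) * ψ F
  split : ∀ b → ∑ Sₖ (λ F → 𝟙 (eqSub (false ∷ F) (b ∷ V)) * ψ (false ∷ F))
                + ∑ Sₖ (λ F → 𝟙 (eqSub (true ∷ F) (b ∷ V)) * ψ (true ∷ F)) ≡ ψ (b ∷ V)
  split true  = cong₂ _+_ (∑-zero Sₖ (λ _ → refl)) (∑-allSubsets-𝟙eqSub* k V (ψ ∘ (true ∷_)))
  split false = trans (cong₂ _+_ (∑-allSubsets-𝟙eqSub* k V (ψ ∘ (false ∷_))) (∑-zero Sₖ (λ _ → refl))) (+-identityʳ _)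

card≡∑𝟙lookup : ∀ {k} (E : Vec Bool k) → card E ≡ sumFin k (𝟙 ∘ lookup E)
card≡∑𝟙lookup []                = refl
card≡∑𝟙lookup {suc k} (b ∷ E) = trans (head+card b) (sym (sumFin-suc k (𝟙 ∘ lookup (b ∷ E))))
  where
  head+card : ∀ b → card (b ∷ E) ≡ 𝟙 b + sumFin k (𝟙 ∘ lookup E)
  head+card true  = cong suc (card≡∑𝟙lookup E)
  head+card false = card≡∑𝟙lookup E

card-tabulate : ∀ k (f : Fin k → Bool) → card (tabulateᵛ f) ≡ sumFin k (𝟙 ∘ f)
card-tabulate k f = trans (card≡∑𝟙lookup (tabulateᵛ f)) (∑-cong (allFin k) (λ i → cong 𝟙 (lookup∘tabulate f i)))

card-[]≔false : ∀ {k} (E : Vec Bool k) i → T (lookup E i) → suc (card (E [ i ]≔ false)) ≡ card E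
card-[]≔false (true ∷ E)  zero    _   = refl
card-[]≔false (true ∷ E)  (suc i) Eᵢ = cong suc (card-[]≔false E i Eᵢ)
card-[]≔false (false ∷ E) (suc i) Eᵢ = card-[]≔false E i Eᵢ

-- The volume of the EM simplex

module EMSimplexProperties {U : Set} (univ : List U) {d : ℕ} (X : Fin (suc d) → U → Bool) where
  open EMSimplex univ X

  private
    Vs = allFin (suc d)
    Faces = allSubsets (suc d)

  codeg : U → ℕ
  codeg x = sumFin (suc d) (λ i → 𝟙 (not (X i x)))

  deg+codeg≡ : ∀ x → deg x + codeg x ≡ suc d
  deg+codeg≡ x = trans (sym (∑-distrib-+ Vs (λ i → 𝟙 (X i x)) (λ i → 𝟙 (not (X i x)))))
                       (trans (∑-cong Vs (λ i → 𝟙+𝟙-not (X i x))) (sumFin-1 (suc d)))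

  mismatches : U → Bool → ℕ
  mismatches x b = sumFin (suc d) (λ i → 𝟙 (X i x xor b))

  mismatches-false : ∀ x → mismatches x false ≡ deg x
  mismatches-false x = ∑-cong Vs (λ i → cong 𝟙 (xor-identityʳ (X i x)))

  mismatches-true : ∀ x → mismatches x true ≡ codeg x
  mismatches-true x = ∑-cong Vs (λ i → cong 𝟙 (xor-comm (X i x) true))

  majority : U → Bool
  majority x = not (2 * deg x ≤ᵇ suc d)

  card-ε≡mismatches-majority : ∀ x → card (ε x) ≡ mismatches x (majority x)
  card-ε≡mismatches-majority x =
    trans (card-tabulate (suc d) (λ i → if 2 * deg x ≤ᵇ suc d then X i x else not (X i x)))
          (by-cases (2 * deg x ≤ᵇ suc d))
    where
    by-cases : ∀ c → sumFin (suc d) (λ i → 𝟙 (if c then X i x else not (X i x))) ≡ mismatches x (not c)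
    by-cases true  = sym (mismatches-false x)
    by-cases false = sym (mismatches-true x)

  card-ε≡deg⊓codeg : ∀ x → card (ε x) ≡ deg x ⊓ codeg x
  card-ε≡deg⊓codeg x = trans (card-ε≡mismatches-majority x) (by-cases (2 * deg x ≤ᵇ suc d) refl)
    where
    by-cases : ∀ c → (2 * deg x ≤ᵇ suc d) ≡ c → mismatches x (not c) ≡ deg x ⊓ codeg x
    by-cases true  le = trans (mismatches-false x) (sym (m≤n⇒m⊓n≡m (2*m≤m+n⇒m≤n
      (subst (2 * deg x ≤_) (sym (deg+codeg≡ x)) (≤ᵇ⇒≤ _ _ (Equivalence.from T-≡ le))))))
    by-cases false gt = trans (mismatches-true x) (sym (m≥n⇒m⊓n≡n (<⇒≤ (≰⇒> λ deg≤codeg →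
      subst T gt (≤⇒≤ᵇ (subst (2 * deg x ≤_) (deg+codeg≡ x) (m≤n⇒2*m≤m+n deg≤codeg)))))))

  card-ε≤mismatches : ∀ x b → card (ε x) ≤ mismatches x b
  card-ε≤mismatches x false =
    subst₂ _≤_ (sym (card-ε≡deg⊓codeg x)) (sym (mismatches-false x)) (m⊓n≤m (deg x) (codeg x))
  card-ε≤mismatches x true  =
    subst₂ _≤_ (sym (card-ε≡deg⊓codeg x)) (sym (mismatches-true x)) (m⊓n≤n (deg x) (codeg x))

  2*card-ε≤ : ∀ x → 2 * card (ε x) ≤ suc d
  2*card-ε≤ x = begin
    2 * card (ε x)                 ≡⟨ cong (2 *_) (card-ε≡deg⊓codeg x) ⟩
    deg x ⊓ codeg x + (deg x ⊓ codeg x + 0)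
      ≤⟨ +-mono-≤ (m⊓n≤m (deg x) (codeg x)) (≤-trans (≤-reflexive (+-identityʳ _)) (m⊓n≤n (deg x) (codeg x))) ⟩
    deg x + codeg x                ≡⟨ deg+codeg≡ x ⟩
    suc d                          ∎
    where open ≤-Reasoning

  card-ε-∉⋃ : ∀ x → inUnion x ≡ false → card (ε x) ≡ 0
  card-ε-∉⋃ x x∉⋃ =
    n≤0⇒n≡0 (≤-trans (card-ε≤mismatches x false) (≤-reflexive (trans (mismatches-false x) deg≡0)))
    where
    deg≡0 : deg x ≡ 0
    deg≡0 = n≤0⇒n≡0 (≮⇒≥ λ 0<deg → subst T x∉⋃ (≤⇒≤ᵇ 0<deg))

  ε-is-cofacet : Face d → Fin (suc d) → U → Bool
  ε-is-cofacet F i x = not (lookup F i) ∧ eqSub (ε x) (F [ i ]≔ true)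

  size-λ1≡ : ∀ F → size-λ1 F ≡ ∑ Vs (λ i → ∑ univ (λ x → 𝟙 (ε-is-cofacet F i x) * 𝟙 (inUnion x)))
  size-λ1≡ F = trans (∑-concatMap cofacet-at Vs size-λ0) (∑-cong Vs size-λ0-cofacet-at)
    where
    cofacet-at : Fin (suc d) → List (Face d)
    cofacet-at i = if lookup F i then [] else (tabulateᵛ (λ j → if ⌊ j ≟ i ⌋ then true else lookup F j) ∷ [])
    size-λ0-cofacet-at : ∀ i → ∑ (cofacet-at i) size-λ0 ≡ ∑ univ (λ x → 𝟙 (ε-is-cofacet F i x) * 𝟙 (inUnion x))
    size-λ0-cofacet-at i with lookup F i
    ... | true  = sym (∑-zero univ (λ _ → refl))
    ... | false = begin
      size-λ0 (tabulateᵛ (λ j → if ⌊ j ≟ i ⌋ then true else lookup F j)) + 0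
        ≡⟨ trans (+-identityʳ _) (cong size-λ0 (tabulate-insert≡[]≔true F i)) ⟩
      size-λ0 (F [ i ]≔ true)
        ≡⟨ length-filter≡∑𝟙 (λ x → inUnion x ∧ eqSub (ε x) (F [ i ]≔ true)) univ ⟩
      ∑ univ (λ x → 𝟙 (inUnion x ∧ eqSub (ε x) (F [ i ]≔ true)))
        ≡⟨ ∑-cong univ (λ x → trans (𝟙-∧ (inUnion x) _) (*-comm (𝟙 (inUnion x)) _)) ⟩
      ∑ univ (λ x → 𝟙 (eqSub (ε x) (F [ i ]≔ true)) * 𝟙 (inUnion x)) ∎
      where open ≡-Reasoning

  contribution : Face d → Fin (suc d) → U → ℕ
  contribution F i x = 𝟙 (lowFace F) * (𝟙 (ε-is-cofacet F i x) * 𝟙 (inUnion x))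

  lowFace-remove : ∀ x i → T (lookup (ε x) i) → T (lowFace (ε x [ i ]≔ false))
  lowFace-remove x i i∈εx = ≤⇒≤ᵇ (≤-pred (begin
    suc (suc (2 * card (ε x [ i ]≔ false)))  ≡⟨ *-suc 2 (card (ε x [ i ]≔ false)) ⟨
    2 * suc (card (ε x [ i ]≔ false))        ≡⟨ cong (2 *_) (card-[]≔false (ε x) i i∈εx) ⟩
    2 * card (ε x)                          ≤⟨ 2*card-ε≤ x ⟩
    suc d                                   ∎))
    where open ≤-Reasoning

  ∑-faces-contribution : ∀ x i → ∑ Faces (λ F → contribution F i x) ≡ 𝟙 (inUnion x) * 𝟙 (lookup (ε x) i)
  ∑-faces-contribution x i = begin
    ∑ Faces (λ F → contribution F i x)             ≡⟨ ∑-cong Faces reshape ⟩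
    ∑ Faces (λ F → 𝟙 (eqSub F ε∖i) * weight F)     ≡⟨ ∑-allSubsets-𝟙eqSub* (suc d) ε∖i weight ⟩
    weight ε∖i                                     ≡⟨ cong (𝟙 (inUnion x) *_) (𝟙*𝟙≡𝟙ʳ _ _ (lowFace-remove x i)) ⟩
    𝟙 (inUnion x) * 𝟙 (lookup (ε x) i)             ∎
    where
    open ≡-Reasoning
    ε∖i : Face d
    ε∖i = ε x [ i ]≔ false
    weight : Face d → ℕ
    weight F = 𝟙 (inUnion x) * (𝟙 (lowFace F) * 𝟙 (lookup (ε x) i))
    rearrange : ∀ a l e u → a * (l * e * u) ≡ e * (u * (a * l))
    rearrange = solve-∀
    reshape : ∀ F → contribution F i x ≡ 𝟙 (eqSub F ε∖i) * weight F
    reshape F = begin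
      𝟙 (lowFace F) * (𝟙 (ε-is-cofacet F i x) * 𝟙 (inUnion x))
        ≡⟨ cong (λ e → 𝟙 (lowFace F) * (𝟙 e * 𝟙 (inUnion x))) (insert-eqSub≡remove-eqSub (ε x) F i) ⟩
      𝟙 (lowFace F) * (𝟙 (lookup (ε x) i ∧ eqSub F ε∖i) * 𝟙 (inUnion x))
        ≡⟨ cong (λ e → 𝟙 (lowFace F) * (e * 𝟙 (inUnion x))) (𝟙-∧ (lookup (ε x) i) (eqSub F ε∖i)) ⟩
      𝟙 (lowFace F) * (𝟙 (lookup (ε x) i) * 𝟙 (eqSub F ε∖i) * 𝟙 (inUnion x))
        ≡⟨ rearrange (𝟙 (lowFace F)) (𝟙 (lookup (ε x) i)) (𝟙 (eqSub F ε∖i)) (𝟙 (inUnion x)) ⟩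
      𝟙 (eqSub F ε∖i) * weight F ∎

  ∑-vertices : ∀ x → ∑ Vs (λ i → 𝟙 (inUnion x) * 𝟙 (lookup (ε x) i)) ≡ card (ε x)
  ∑-vertices x = trans (sym (*-distribˡ-∑ (𝟙 (inUnion x)) Vs (𝟙 ∘ lookup (ε x))))
    (trans (cong (𝟙 (inUnion x) *_) (sym (card≡∑𝟙lookup (ε x)))) (by-cases (inUnion x) refl))
    where
    by-cases : ∀ b → inUnion x ≡ b → 𝟙 b * card (ε x) ≡ card (ε x)
    by-cases true  _   = *-identityˡ (card (ε x))
    by-cases false x∉⋃ = sym (card-ε-∉⋃ x x∉⋃)

  Vol≡∑card-ε : Vol ≡ ∑ univ (card ∘ ε)
  Vol≡∑card-ε = begin
    Vol
      ≡⟨ ∑-cong Faces (λ F → trans (if-then-0≡𝟙* (lowFace F) (size-λ1 F)) (cong (𝟙 (lowFace F) *_) (size-λ1≡ F))) ⟩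
    ∑ Faces (λ F → 𝟙 (lowFace F) * ∑ Vs (λ i → ∑ univ (λ x → 𝟙 (ε-is-cofacet F i x) * 𝟙 (inUnion x))))
      ≡⟨ ∑-cong Faces (λ F → trans (*-distribˡ-∑ (𝟙 (lowFace F)) Vs _)
                                    (∑-cong Vs (λ i → *-distribˡ-∑ (𝟙 (lowFace F)) univ _))) ⟩
    ∑ Faces (λ F → ∑ Vs (λ i → ∑ univ (contribution F i)))
      ≡⟨ ∑-cong Faces (λ F → ∑-comm Vs univ _) ⟩
    ∑ Faces (λ F → ∑ univ (λ x → ∑ Vs (λ i → contribution F i x)))
      ≡⟨ ∑-comm Faces univ _ ⟩
    ∑ univ (λ x → ∑ Faces (λ F → ∑ Vs (λ i → contribution F i x)))
      ≡⟨ ∑-cong univ (λ x → ∑-comm Faces Vs _) ⟩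
    ∑ univ (λ x → ∑ Vs (λ i → ∑ Faces (λ F → contribution F i x)))
      ≡⟨ ∑-cong univ (λ x → trans (∑-cong Vs (∑-faces-contribution x)) (∑-vertices x)) ⟩
    ∑ univ (card ∘ ε) ∎
    where open ≡-Reasoning

-- Cumulative histograms as sets of dots

dots-monotone : ∀ {n m} (h : Histogram n) (k : Fin m) → Monotone (λ j → dots h (j , k))
dots-monotone h k a≤b k<Hₐ = <⇒<ᵇ (<-≤-trans (<ᵇ⇒< _ _ k<Hₐ) (cumulative-mono-≤ h a≤b))

dots-fromℕ : ∀ {n m} (h : Histogram (suc n)) → total h ≡ m → (k : Fin m) → T (dots h (fromℕ n , k))
dots-fromℕ {n} {m} h total≡m k = <⇒<ᵇ (subst (toℕ k <_) (sym H≡m) (toℕ<n k))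
  where
  H≡m : cumulative h (fromℕ n) ≡ m
  H≡m = trans (cumulative≡prefixSum h (fromℕ n)) (trans (prefixSum-fromℕ h) total≡m)

module DotFamily {n m d : ℕ} (h : Fin (suc d) → Histogram n) where

  X : Fin (suc d) → Fin n × Fin m → Bool
  X i = dots (h i)

  open EMSimplex (dotUniverse n m) X public
  open EMSimplexProperties (dotUniverse n m) X public

  private
    Vs = allFin (suc d)
    Fn = allFin n
    Fm = allFin m

  VolEM≡∑∑card-ε : VolEM m h ≡ sumFin n (λ j → sumFin m (λ k → card (ε (j , k))))
  VolEM≡∑∑card-ε = trans Vol≡∑card-ε
    (trans (∑-concatMap (λ j → map (j ,_) Fm) Fn (card ∘ ε)) (∑-cong Fn (λ j → ∑-map (j ,_) Fm (card ∘ ε))))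

  VolEM≤totalWork : ∀ g τ → (∀ i → IsPlan (h i) g (τ i)) → VolEM m h ≤ totalWork τ
  VolEM≤totalWork g τ plans = begin
    VolEM m h
      ≡⟨ VolEM≡∑∑card-ε ⟩
    ∑ Fn (λ j → ∑ Fm (λ k → card (ε (j , k))))
      ≤⟨ ∑-mono-≤ Fn (λ j → ∑-mono-≤ Fm (λ k → card-ε≤mismatches (j , k) (toℕ k <ᵇ cumulative g j))) ⟩
    ∑ Fn (λ j → ∑ Fm (λ k → ∑ Vs (λ i → 𝟙 (X i (j , k) xor (toℕ k <ᵇ cumulative g j)))))
      ≡⟨ ∑-rotate Vs Fn Fm _ ⟨
    ∑ Vs (λ i → ∑ Fn (λ j → ∑ Fm (λ k → 𝟙 ((toℕ k <ᵇ cumulative (h i) j) xor (toℕ k <ᵇ cumulative g j)))))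
      ≤⟨ ∑-mono-≤ Vs (λ i → ∑-mono-≤ Fn (λ j →
           ∑𝟙-xor-<ᵇ≤∣-∣ m (cumulative (h i) j) (cumulative g j))) ⟩
    ∑ Vs (λ i → ∑ Fn (λ j → ∣ cumulative (h i) j - cumulative g j ∣))
      ≤⟨ ∑-mono-≤ Vs (λ i → ∑∣cumulative-cumulative∣≤work (plans i)) ⟩
    totalWork τ ∎
    where open ≤-Reasoning

module MedianTransport {n m d : ℕ} (h : Fin (suc d) → Histogram (suc n)) (total≡m : ∀ i → total (h i) ≡ m) where

  open DotFamily {m = m} h

  private
    Vs = allFin (suc d)
    Fn = allFin (suc n)
    Fm = allFin m

  binOf : Fin (suc d) → Fin m → Fin (suc n)
  binOf i k = least (λ j → X i (j , k))

  binOf-≤ᶠ : ∀ i k j → binOf i k ≤ᶠ j ≡ X i (j , k)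
  binOf-≤ᶠ i k = least-≤ᶠ (λ j → X i (j , k)) (dots-monotone (h i) k) (dots-fromℕ (h i) (total≡m i) k)

  majority-monotone : ∀ k → Monotone (λ j → majority (j , k))
  majority-monotone k {a} {b} a≤b maj = >⇒T-not-≤ᵇ (<-≤-trans (T-not-≤ᵇ⇒> maj) (*-monoʳ-≤ 2 deg-mono))
    where
    deg-mono : deg (a , k) ≤ deg (b , k)
    deg-mono = ∑-mono-≤ Vs (λ i → 𝟙-mono-≤ (dots-monotone (h i) k a≤b))

  majority-fromℕ : ∀ k → T (majority (fromℕ n , k))
  majority-fromℕ k = >⇒T-not-≤ᵇ (subst (λ e → suc d < 2 * e) (sym deg≡) (m<m+n (suc d) z<s))
    where
    deg≡ : deg (fromℕ n , k) ≡ suc d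
    deg≡ = trans (∑-cong Vs (λ i → cong 𝟙 (Equivalence.to T-≡ (dots-fromℕ (h i) (total≡m i) k)))) (sumFin-1 (suc d))

  medianBin : Fin m → Fin (suc n)
  medianBin k = least (λ j → majority (j , k))

  medianBin-≤ᶠ : ∀ k j → medianBin k ≤ᶠ j ≡ majority (j , k)
  medianBin-≤ᶠ k = least-≤ᶠ (λ j → majority (j , k)) (majority-monotone k) (majority-fromℕ k)

  median : Histogram (suc n)
  median = histogramOf medianBin

  histogramOf-binOf : ∀ i a → histogramOf (binOf i) a ≡ h i a
  histogramOf-binOf i = prefixSum-injective λ j → begin
    prefixSum (histogramOf (binOf i)) j         ≡⟨ prefixSum-histogramOf (binOf i) j ⟩
    ∑ Fm (λ k → 𝟙 (binOf i k ≤ᶠ j))            ≡⟨ ∑-cong Fm (λ k → cong 𝟙 (binOf-≤ᶠ i k j)) ⟩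
    ∑ Fm (λ k → 𝟙 (toℕ k <ᵇ cumulative (h i) j)) ≡⟨ ∑𝟙<ᵇ≡ m (cumulative (h i) j) (cumulative≤m j) ⟩
    cumulative (h i) j                          ≡⟨ cumulative≡prefixSum (h i) j ⟩
    prefixSum (h i) j                           ∎
    where
    open ≡-Reasoning
    cumulative≤m : ∀ j → cumulative (h i) j ≤ m
    cumulative≤m j = subst₂ _≤_ (sym (cumulative≡prefixSum (h i) j)) (total≡m i) (prefixSum≤sumFin (h i) j)

  plan : Fin (suc d) → Fin (suc n) → Fin (suc n) → ℕ
  plan i = coupling (binOf i) medianBin

  plan-isPlan : ∀ i → IsPlan (h i) median (plan i)
  plan-isPlan i with coupling-isPlan (binOf i) medianBin
  ... | rows , cols = (λ a → trans (rows a) (histogramOf-binOf i a)) , cols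

  totalWork-plan : totalWork plan ≡ VolEM m h
  totalWork-plan = begin
    ∑ Vs (λ i → work (plan i))
      ≡⟨ ∑-cong Vs (λ i → trans (work-coupling (binOf i) medianBin)
           (∑-cong Fm (λ k → ∣toℕ-toℕ∣≡∑𝟙-xor (suc n) (binOf i k) (medianBin k)))) ⟩
    ∑ Vs (λ i → ∑ Fm (λ k → ∑ Fn (λ j → 𝟙 ((binOf i k ≤ᶠ j) xor (medianBin k ≤ᶠ j)))))
      ≡⟨ ∑-cong Vs (λ i → trans (∑-comm Fm Fn _) (∑-cong Fn (λ j → ∑-cong Fm (λ k →
           cong₂ (λ p q → 𝟙 (p xor q)) (binOf-≤ᶠ i k j) (medianBin-≤ᶠ k j))))) ⟩
    ∑ Vs (λ i → ∑ Fn (λ j → ∑ Fm (λ k → 𝟙 (X i (j , k) xor majority (j , k)))))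
      ≡⟨ ∑-rotate Vs Fn Fm _ ⟩
    ∑ Fn (λ j → ∑ Fm (λ k → mismatches (j , k) (majority (j , k))))
      ≡⟨ ∑-cong Fn (λ j → ∑-cong Fm (λ k → card-ε≡mismatches-majority (j , k))) ⟨
    ∑ Fn (λ j → ∑ Fm (λ k → card (ε (j , k))))
      ≡⟨ VolEM≡∑∑card-ε ⟨
    VolEM m h ∎
    where open ≡-Reasoning

corollary3p6 : (n m d : ℕ) (h : Fin (suc d) → Histogram n) →
    ((i : Fin (suc d)) → total (h i) ≡ m) →
    IsEMD h (VolEM m h)
corollary3p6 zero    m d h _       =
  ((λ ()) , (λ _ ()) , (λ _ → (λ ()) , (λ ())) ,
   trans (∑-zero (allFin (suc d)) (λ _ → refl)) (sym (DotFamily.VolEM≡∑∑card-ε {m = m} h)))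
  , DotFamily.VolEM≤totalWork {m = m} h
corollary3p6 (suc n) m d h total≡m =
  (median , plan , plan-isPlan , totalWork-plan) , DotFamily.VolEM≤totalWork {m = m} h
  where open MedianTransport h total≡m
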